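{- For every instance of DDP-SC in which all battery stations are swapping stations and every $\ell$ with $1\le\ell\le r+1$, $\widetilde{OPT}_\ell\le OPT_{SC}$, where $\widetilde{OPT}_\ell$ is the minimum number of blocks in a partition of $\widetilde{\mathcal I}_\ell$ into blocks.
   Context: Model: $n$ deliveries with closed delivery time intervals $I_j=[t_j^L,t_j^R]$ and costs $cost(I_j)\in(0,B]$, $B>0$ the battery capacity of identical drones; intervals are compatible if disjoint. $r$ swapping stations with swapping intervals $I_\ell^c=[t_\ell^A,t_\ell^D]$, $t_1^A<t_1^D<\dots<t_r^A<t_r^D$; no delivery interval is contained in a swapping interval and none intersects two of them. A drone swapping its battery at station $\ell$ occupies all of $I_\ell^c$, ends with battery $B$, and cannot serve deliveries intersecting $I_\ell^c$; several drones may swap simultaneously. A drone starts with battery $B$; a feasible assignment is a set of delivery intervals and swapping intervals, pairwise disjoint, such that in time order each delivery's cost is at most the remaining battery when taken. $OPT_{SC}$ is the minimum number of drones such that every delivery is assigned to exactly one drone and all assignments are feasible. $\widetilde{\mathcal I}_1=\{I_j: t_j^L\le t_1^D\}$, $\widetilde{\mathcal I}_\ell=\{I_j: t_{\ell-1}^D<t_j^L\le t_\ell^D\}$ for $2\le\ell\le r$, $\widetilde{\mathcal I}_{r+1}=\{I_j: t_j^L>t_r^D\}$. A block is a pairwise compatible set of delivery intervals of total cost at most $B$.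
   Formalization: The delivery and swapping times, the delivery costs and the battery capacity B are rational numbers rather than real numbers. -}

module Defs where

open import Data.Nat using (ℕ; zero; suc)
open import Data.Fin using (Fin; zero; suc; toℕ)
open import Data.Rational using (ℚ; 0ℚ; _≤_; _<_; _+_; _-_)
open import Data.List using (List; []; _∷_; foldr; map)
open import Data.List.Membership.Propositional using (_∈_)
open import Data.List.Relation.Unary.Linked using (Linked)
open import Data.List.Relation.Unary.AllPairs using (AllPairs)
open import Data.List.Relation.Unary.Unique.Propositional using (Unique)
open import Data.List.Relation.Unary.All using (All)
open import Data.Product using (Σ; ∃; _×_)
open import Data.Sum using (_⊎_)
open import Data.Unit using (⊤)
open import Relation.Nullary using (¬_)
open import Relation.Binary.PropositionalEquality using (_≡_; _≢_)
import Data.Nat as N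

Intersect : ℚ → ℚ → ℚ → ℚ → Set
Intersect a b c d = (a ≤ d) × (c ≤ b)

Disjoint : ℚ → ℚ → ℚ → ℚ → Set
Disjoint a b c d = (b < c) ⊎ (d < a)

-- An instance of DDP-SC (all stations are swapping stations).
-- Deliveries are indexed by Fin n, swapping stations by Fin r
-- (station index i : Fin r corresponds to the paper's station i+1).
record Instance : Set where
  field
    n r  : ℕ
    B    : ℚ
    B-pos : 0ℚ < B
    tL tR cost : Fin n → ℚ
    tA tD : Fin r → ℚ
    tL≤tR : ∀ j → tL j ≤ tR j
    cost-pos : ∀ j → 0ℚ < cost j
    cost≤B : ∀ j → cost j ≤ B
    tA<tD : ∀ ℓ → tA ℓ < tD ℓ
    stations-ordered : ∀ (ℓ ℓ' : Fin r) → toℕ ℓ N.< toℕ ℓ' → tD ℓ < tA ℓ'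
    not-contained : ∀ j ℓ → ¬ ((tA ℓ ≤ tL j) × (tR j ≤ tD ℓ))
    not-two : ∀ j ℓ ℓ' → Intersect (tL j) (tR j) (tA ℓ) (tD ℓ)
                       → Intersect (tL j) (tR j) (tA ℓ') (tD ℓ') → ℓ ≡ ℓ'

module _ (I : Instance) where
  open Instance I

  data Event : Set where
    del : Fin n → Event
    swp : Fin r → Event

  left right : Event → ℚ
  left (del j) = tL j
  left (swp ℓ) = tA ℓ
  right (del j) = tR j
  right (swp ℓ) = tD ℓ

  Chronological : List Event → Set
  Chronological = Linked (λ e e' → right e < left e')

  BatteryOK : ℚ → List Event → Set
  BatteryOK b [] = ⊤
  BatteryOK b (del j ∷ es) = (cost j ≤ b) × BatteryOK (b - cost j) es
  BatteryOK b (swp ℓ ∷ es) = BatteryOK B es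

  FeasibleAssignment : List Event → Set
  FeasibleAssignment es = Chronological es × BatteryOK B es

  ValidSchedule : (m : ℕ) → (Fin m → List Event) → Set
  ValidSchedule m S =
    (∀ i → FeasibleAssignment (S i)) ×
    (∀ j → ∃ λ i → del j ∈ S i) ×
    (∀ j i i' → del j ∈ S i → del j ∈ S i' → i ≡ i')

  IsOPT-SC : ℕ → Set
  IsOPT-SC m = (∃ λ S → ValidSchedule m S) ×
               (∀ m' → (S : Fin m' → List Event) → ValidSchedule m' S → m N.≤ m')

  -- Membership of a delivery in Ĩ_ℓ, ℓ : Fin (suc r) (index k ↔ paper's ℓ = k+1).
  Below : ∀ {r'} → (Fin r' → ℚ) → Fin (suc r') → ℚ → Set
  Below D zero t = ⊤
  Below D (suc k) t = D k < t

  Above : ∀ {r'} → (Fin r' → ℚ) → Fin (suc r') → ℚ → Set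
  Above {zero} D zero t = ⊤
  Above {suc r'} D zero t = t ≤ D zero
  Above {suc r'} D (suc k) t = Above (λ x → D (suc x)) k t

  InTilde : Fin (suc r) → Fin n → Set
  InTilde ℓ j = Below tD ℓ (tL j) × Above tD ℓ (tL j)

  Compatible : Fin n → Fin n → Set
  Compatible j k = Disjoint (tL j) (tR j) (tL k) (tR k)

  totalCost : List (Fin n) → ℚ
  totalCost js = foldr (λ j s → cost j + s) 0ℚ js

  IsBlock : List (Fin n) → Set
  IsBlock js = Unique js × AllPairs Compatible js × (totalCost js ≤ B)

  IsBlockPartition : Fin (suc r) → (k : ℕ) → (Fin k → List (Fin n)) → Set
  IsBlockPartition ℓ k P =
    (∀ b → IsBlock (P b)) ×
    (∀ b → P b ≢ []) ×
    (∀ b → All (InTilde ℓ) (P b)) ×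
    (∀ j → InTilde ℓ j → ∃ λ b → j ∈ P b) ×
    (∀ j b b' → j ∈ P b → j ∈ P b' → b ≡ b')

  IsOPT-tilde : Fin (suc r) → ℕ → Set
  IsOPT-tilde ℓ k = (∃ λ P → IsBlockPartition ℓ k P) ×
                    (∀ k' → (P : Fin k' → List (Fin n)) → IsBlockPartition ℓ k' P → k N.≤ k')

-- All deliveries of Ĩ_ℓ start in the window (t_{ℓ-1}^D, t_ℓ^D], and no swapping interval
-- fits between two start times in that window.  So once a drone has begun serving
-- Ĩ_ℓ it cannot swap before its last Ĩ_ℓ-delivery, and the Ĩ_ℓ-deliveries of each
-- drone are paid from one battery charge: they form a block.  The nonempty ones among
-- these blocks partition Ĩ_ℓ into at most OPT_SC blocks.
module Submission where

open import Defs
open import Data.Nat using (ℕ; suc; _≤_)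
open import Data.Fin using (Fin)

import Data.Nat as ℕ
import Data.Nat.Properties as ℕP
open import Data.Fin using (zero; suc; toℕ)
open import Data.Fin.Properties using (suc-injective; toℕ-injective; injective⇒≤)
open import Data.Rational using (ℚ; 0ℚ; _+_; _-_; -_) renaming (_≤_ to _≤q_; _<_ to _<q_)
open import Data.Rational.Properties
  using (≤-refl; ≤-reflexive; ≤-trans; <-trans; ≤-<-trans; <-≤-trans; <⇒≤; <-irrefl; _≤?_; _<?_;
         +-assoc; +-identityʳ; +-inverseʳ; +-monoˡ-≤; +-monoʳ-≤; neg-antimono-≤;
         +-0-abelianGroup)
open import Algebra.Properties.AbelianGroup +-0-abelianGroup using (xyx⁻¹≈y)
open import Data.List using (List; []; _∷_; filter)
open import Data.List.Properties using (filter-none)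
open import Data.List.Membership.Propositional using (_∈_)
open import Data.List.Membership.Propositional.Properties using (∈-filter⁺; ∈-filter⁻)
open import Data.List.Relation.Unary.Any using (here; there)
open import Data.List.Relation.Unary.All as All using (All; []; _∷_)
open import Data.List.Relation.Unary.AllPairs as AllPairs using (AllPairs; []; _∷_)
import Data.List.Relation.Unary.AllPairs.Properties as AllPairsP
open import Data.List.Relation.Unary.Linked.Properties using (Linked⇒AllPairs)
open import Data.Product using (∃; _×_; _,_; proj₁; proj₂)
open import Data.Sum using (inj₁; inj₂)
open import Data.Unit using (tt)
open import Data.Empty using (⊥-elim)
open import Function using (_∘_)
open import Function.Definitions using (Injective)
open import Relation.Nullary using (¬_; Dec; yes; no; contradiction)
open import Relation.Nullary.Decidable using (_×-dec_)
open import Relation.Binary.PropositionalEquality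

≤⇒≯ : ∀ {p q} → p ≤q q → ¬ q <q p
≤⇒≯ p≤q q<p = <-irrefl refl (≤-<-trans p≤q q<p)

q≤p⇒0≤p-q : ∀ {p q} → q ≤q p → 0ℚ ≤q p - q
q≤p⇒0≤p-q {p} {q} q≤p = subst (_≤q p - q) (+-inverseʳ q) (+-monoˡ-≤ (- q) q≤p)

0<q⇒p-q≤p : ∀ {p q} → 0ℚ <q q → p - q ≤q p
0<q⇒p-q≤p {p} 0<q =
  ≤-trans (+-monoʳ-≤ p (neg-antimono-≤ (<⇒≤ 0<q))) (≤-reflexive (+-identityʳ p))

r≤p-q⇒q+r≤p : ∀ {p q r} → r ≤q p - q → q + r ≤q p
r≤p-q⇒q+r≤p {p} {q} r≤p-q = subst (q + _ ≤q_) q+[p-q]≡p (+-monoʳ-≤ q r≤p-q)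
  where
  q+[p-q]≡p : q + (p - q) ≡ p
  q+[p-q]≡p = trans (sym (+-assoc q p (- q))) (xyx⁻¹≈y q p)

record Compaction {A : Set} {m : ℕ} (Q : Fin m → List A) : Set where
  field
    size : ℕ
    index : Fin size → Fin m
    index-injective : Injective _≡_ _≡_ index
    index-nonempty : ∀ b → Q (index b) ≢ []
    index-onto-nonempty : ∀ i → Q i ≢ [] → ∃ λ b → index b ≡ i

  size≤ : size ≤ m
  size≤ = injective⇒≤ index-injective

compaction : ∀ {A : Set} {m} (Q : Fin m → List A) → Compaction Q
compaction {m = ℕ.zero} Q = record
  { size = 0 ; index = λ () ; index-injective = λ { {()} } ; index-nonempty = λ ()
  ; index-onto-nonempty = λ () }
compaction {m = suc m} Q with Q zero in eq
... | [] = record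
  { size = size ; index = suc ∘ index ; index-injective = index-injective ∘ suc-injective
  ; index-nonempty = index-nonempty ; index-onto-nonempty = onto }
  where
  open Compaction (compaction (Q ∘ suc))
  onto : ∀ i → Q i ≢ [] → ∃ λ b → suc (index b) ≡ i
  onto zero Qzero≢[] = contradiction eq Qzero≢[]
  onto (suc i) Qi≢[] = let b , eqb = index-onto-nonempty i Qi≢[] in b , cong suc eqb
... | _ ∷ _ = record
  { size = suc size ; index = index′ ; index-injective = injective
  ; index-nonempty = nonempty ; index-onto-nonempty = onto }
  where
  open Compaction (compaction (Q ∘ suc))
  index′ : Fin (suc size) → Fin (suc m)
  index′ zero = zero
  index′ (suc b) = suc (index b)
  injective : Injective _≡_ _≡_ index′
  injective {zero} {zero} _ = refl
  injective {suc b} {suc b′} e = cong suc (index-injective (suc-injective e))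
  nonempty : ∀ b → Q (index′ b) ≢ []
  nonempty zero Qzero≡[] with () ← trans (sym eq) Qzero≡[]
  nonempty (suc b) = index-nonempty b
  onto : ∀ i → Q i ≢ [] → ∃ λ b → index′ b ≡ i
  onto zero _ = zero , refl
  onto (suc i) Qi≢[] = let b , eqb = index-onto-nonempty i Qi≢[] in suc b , cong suc eqb

∈⇒≢[] : ∀ {A : Set} {x : A} {xs} → x ∈ xs → xs ≢ []
∈⇒≢[] (here _) ()
∈⇒≢[] (there _) ()

module _ (I : Instance) where
  open Instance I

  tD-mono : ∀ {s s′} → toℕ s ≤ toℕ s′ → tD s ≤q tD s′
  tD-mono {s} {s′} s≤s′ with ℕP.m≤n⇒m<n∨m≡n s≤s′
  ... | inj₁ s<s′ = <⇒≤ (<-trans (stations-ordered s s′ s<s′) (tA<tD s′))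
  ... | inj₂ s≡s′ rewrite toℕ-injective s≡s′ = ≤-refl

  Above⇒≤ : ∀ {r′} (D : Fin r′ → ℚ) → (∀ {x y} → toℕ x ≤ toℕ y → D x ≤q D y) →
            ∀ k {t} y → Above I D k t → toℕ k ≤ toℕ y → t ≤q D y
  Above⇒≤ {suc r′} D mono zero y t≤D0 _ = ≤-trans t≤D0 (mono ℕ.z≤n)
  Above⇒≤ {suc r′} D mono (suc k) (suc y) above (ℕ.s≤s k≤y) =
    Above⇒≤ (D ∘ suc) (mono ∘ ℕ.s≤s) k y above k≤y

  -- A swap starting after a time t > t_{ℓ-1}^D is at station ℓ or a later one.
  swap-after-window : ∀ ℓ {t k} s → Below I tD ℓ t → t <q tA s → InTilde I ℓ k → tL k ≤q tD s
  swap-after-window ℓ {t} s below t<tAs (_ , above) =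
    Above⇒≤ tD tD-mono ℓ s above (later ℓ below)
    where
    later : ∀ ℓ → Below I tD ℓ t → toℕ ℓ ≤ toℕ s
    later zero _ = ℕ.z≤n
    later (suc p) tDp<t with toℕ s ℕ.≤? toℕ p
    ... | yes s≤p = ⊥-elim (<-irrefl refl (<-trans (<-≤-trans (tA<tD s) (tD-mono s≤p))
                                                   (<-trans tDp<t t<tAs)))
    ... | no s≰p = ℕP.≰⇒> s≰p

  Below? : ∀ {r′} (D : Fin r′ → ℚ) k t → Dec (Below I D k t)
  Below? D zero t = yes tt
  Below? D (suc k) t = D k <? t

  Above? : ∀ {r′} (D : Fin r′ → ℚ) k t → Dec (Above I D k t)
  Above? {ℕ.zero} D zero t = yes tt
  Above? {suc r′} D zero t = t ≤? D zero
  Above? {suc r′} D (suc k) t = Above? (D ∘ suc) k t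

  -- Opaque so that `with InTilde? ℓ k` also abstracts the test made inside `filter`.
  opaque
    InTilde? : ∀ ℓ j → Dec (InTilde I ℓ j)
    InTilde? ℓ j = Below? tD ℓ (tL j) ×-dec Above? tD ℓ (tL j)

  _≺_ : Event I → Event I → Set
  e ≺ e′ = right I e <q left I e′

  ≺-trans : ∀ {e e′ e″} → e ≺ e′ → e′ ≺ e″ → e ≺ e″
  ≺-trans {e′ = del j} e≺e′ e′≺e″ = <-trans e≺e′ (≤-<-trans (tL≤tR j) e′≺e″)
  ≺-trans {e′ = swp s} e≺e′ e′≺e″ = <-trans e≺e′ (<-trans (tA<tD s) e′≺e″)

  deliveries : List (Event I) → List (Fin n)
  deliveries [] = []
  deliveries (del j ∷ es) = j ∷ deliveries es
  deliveries (swp _ ∷ es) = deliveries es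

  ∈-deliveries⁺ : ∀ {j es} → del j ∈ es → j ∈ deliveries es
  ∈-deliveries⁺ {es = del _ ∷ _} (here refl) = here refl
  ∈-deliveries⁺ {es = del _ ∷ _} (there j∈es) = there (∈-deliveries⁺ j∈es)
  ∈-deliveries⁺ {es = swp _ ∷ _} (there j∈es) = ∈-deliveries⁺ j∈es

  ∈-deliveries⁻ : ∀ {j} es → j ∈ deliveries es → del j ∈ es
  ∈-deliveries⁻ (del _ ∷ _) (here refl) = here refl
  ∈-deliveries⁻ (del _ ∷ es) (there j∈es) = there (∈-deliveries⁻ es j∈es)
  ∈-deliveries⁻ (swp _ ∷ es) j∈es = there (∈-deliveries⁻ es j∈es)

  All-deliveries : ∀ {P : Event I → Set} {es} → All P es → All (P ∘ del) (deliveries es)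
  All-deliveries {es = []} [] = []
  All-deliveries {es = del _ ∷ _} (p ∷ ps) = p ∷ All-deliveries ps
  All-deliveries {es = swp _ ∷ _} (_ ∷ ps) = All-deliveries ps

  AllPairs-deliveries : ∀ {R : Event I → Event I → Set} {es} →
                        AllPairs R es → AllPairs (λ j k → R (del j) (del k)) (deliveries es)
  AllPairs-deliveries {es = []} [] = []
  AllPairs-deliveries {es = del _ ∷ _} (r ∷ rs) = All-deliveries r ∷ AllPairs-deliveries rs
  AllPairs-deliveries {es = swp _ ∷ _} (_ ∷ rs) = AllPairs-deliveries rs

  tildeDeliveries : Fin (suc r) → List (Event I) → List (Fin n)
  tildeDeliveries ℓ es = filter (InTilde? ℓ) (deliveries es)

  tildeDeliveries-after≡[] : ∀ ℓ {T} → (∀ {k} → InTilde I ℓ k → tL k ≤q T) →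
                             ∀ {es} → All (λ e → T <q left I e) es → tildeDeliveries ℓ es ≡ []
  tildeDeliveries-after≡[] ℓ starts≤T after =
    filter-none (InTilde? ℓ) (All.map (λ T<tLk tk → ≤⇒≯ (starts≤T tk) T<tLk) (All-deliveries after))

  -- Here t is the start of a Ĩ_ℓ-delivery already served; a later swap leaves no Ĩ_ℓ-delivery.
  tildeDeliveries-cost≤charge : ∀ ℓ {t} → Below I tD ℓ t → ∀ {c} es →
    All (λ e → t <q left I e) es → AllPairs _≺_ es → 0ℚ ≤q c → BatteryOK I c es →
    totalCost I (tildeDeliveries ℓ es) ≤q c
  tildeDeliveries-cost≤charge ℓ below [] _ _ 0≤c _ = 0≤c
  tildeDeliveries-cost≤charge ℓ below (swp s ∷ es) (t<tAs ∷ _) (s≺es ∷ _) 0≤c _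
    rewrite tildeDeliveries-after≡[] ℓ (swap-after-window ℓ s below t<tAs) s≺es = 0≤c
  tildeDeliveries-cost≤charge ℓ below {c} (del k ∷ es) (_ ∷ after) (_ ∷ ≺es) _ (k≤c , ok)
    with InTilde? ℓ k | tildeDeliveries-cost≤charge ℓ below es after ≺es (q≤p⇒0≤p-q k≤c) ok
  ... | yes _ | ih = r≤p-q⇒q+r≤p {c} {cost k} ih
  ... | no _  | ih = ≤-trans ih (0<q⇒p-q≤p (cost-pos k))

  tildeDeliveries-cost≤B : ∀ ℓ {c} es → AllPairs _≺_ es → c ≤q B → BatteryOK I c es →
                           totalCost I (tildeDeliveries ℓ es) ≤q B
  tildeDeliveries-cost≤B ℓ [] _ _ _ = <⇒≤ B-pos
  tildeDeliveries-cost≤B ℓ (swp s ∷ es) (_ ∷ ≺es) _ ok = tildeDeliveries-cost≤B ℓ es ≺es ≤-refl ok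
  tildeDeliveries-cost≤B ℓ {c} (del k ∷ es) (k≺es ∷ ≺es) c≤B (k≤c , ok) with InTilde? ℓ k
  ... | yes (below , _) =
    ≤-trans (r≤p-q⇒q+r≤p {c} {cost k} (tildeDeliveries-cost≤charge ℓ below es
                           (All.map (≤-<-trans (tL≤tR k)) k≺es) ≺es (q≤p⇒0≤p-q k≤c) ok))
            c≤B
  ... | no _ = tildeDeliveries-cost≤B ℓ es ≺es (≤-trans (0<q⇒p-q≤p (cost-pos k)) c≤B) ok

  tildeDeliveries-isBlock : ∀ ℓ {es} → FeasibleAssignment I es → IsBlock I (tildeDeliveries ℓ es)
  tildeDeliveries-isBlock ℓ {es} (chronological , ok) =
    AllPairs.map distinct ordered , AllPairs.map inj₁ ordered ,
    tildeDeliveries-cost≤B ℓ es precedes ≤-refl ok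
    where
    precedes : AllPairs _≺_ es
    precedes = Linked⇒AllPairs (λ {e e′ e″} → ≺-trans {e} {e′} {e″}) chronological
    ordered : AllPairs (λ j k → tR j <q tL k) (tildeDeliveries ℓ es)
    ordered = AllPairsP.filter⁺ (InTilde? ℓ) (AllPairs-deliveries precedes)
    distinct : ∀ {j k} → tR j <q tL k → j ≢ k
    distinct {j} tRj<tLj refl = ≤⇒≯ (tL≤tR j) tRj<tLj

  validSchedule⇒blockPartition : ∀ ℓ {m S} → ValidSchedule I m S →
                                 ∃ λ k → k ≤ m × ∃ (IsBlockPartition I ℓ k)
  validSchedule⇒blockPartition ℓ {m} {S} (feasible , served , servedOnce) =
    size , size≤ , Q ∘ index , blocks , index-nonempty , inTilde , covers , disjoint
    where
    Q : Fin m → List (Fin n)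
    Q i = tildeDeliveries ℓ (S i)
    open Compaction (compaction Q)

    ∈Q⇒∈S : ∀ {j i} → j ∈ Q i → del j ∈ S i
    ∈Q⇒∈S {i = i} = ∈-deliveries⁻ (S i) ∘ proj₁ ∘ ∈-filter⁻ (InTilde? ℓ)

    blocks : ∀ b → IsBlock I (Q (index b))
    blocks b = tildeDeliveries-isBlock ℓ (feasible (index b))

    inTilde : ∀ b → All (InTilde I ℓ) (Q (index b))
    inTilde b = All.tabulate (proj₂ ∘ ∈-filter⁻ (InTilde? ℓ) {xs = deliveries (S (index b))})

    covers : ∀ j → InTilde I ℓ j → ∃ λ b → j ∈ Q (index b)
    covers j tj with i , j∈Si ← served j
                 with j∈Qi ← ∈-filter⁺ (InTilde? ℓ) (∈-deliveries⁺ j∈Si) tj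
                 with b , refl ← index-onto-nonempty i (∈⇒≢[] j∈Qi)
      = b , j∈Qi

    disjoint : ∀ j b b′ → j ∈ Q (index b) → j ∈ Q (index b′) → b ≡ b′
    disjoint j b b′ j∈b j∈b′ = index-injective (servedOnce j _ _ (∈Q⇒∈S j∈b) (∈Q⇒∈S j∈b′))

lemma15 : (I : Instance) (ℓ : Fin (suc (Instance.r I))) (a b : ℕ)
          → IsOPT-tilde I ℓ a → IsOPT-SC I b → a ≤ b
lemma15 I ℓ a b (_ , a-minimal) ((_ , valid) , _)
  with k , k≤b , P , partition ← validSchedule⇒blockPartition I ℓ valid
  = ℕP.≤-trans (a-minimal k P partition) k≤b
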